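{- Let \(D\) be a \(\mathcal V\)-dcpo with a small basis \(\beta : B\to D\), and let \(b\sqsubseteq_\beta c\) denote (a \(\mathcal V\)-valued proposition equivalent to) \(\beta(b)\sqsubseteq\beta(c)\), so that \((B,\sqsubseteq_\beta)\) is an abstract \(\mathcal V\)-basis. Then the map \(D \to \mathrm{Idl}_{\mathcal V}(B,\sqsubseteq_\beta)\) sending \(x\) to \(\{b\in B\mid \beta(b)\ll x\}\) is the embedding in an embedding-projection pair. In particular, \(D\) is a Scott continuous retract of the algebraic dcpo \(\mathrm{Idl}_{\mathcal V}(B,\sqsubseteq_\beta)\), which has a small compact basis. Moreover, if \(\beta\) is a small compact basis, then the map is an isomorphism.
   Context: We work constructively and predicatively in univalent foundations with universes and propositional truncation. A type is \(\mathcal V\)-small if equivalent to a type in \(\mathcal V\). Directed family: inhabited index type and any two indices have (there exists) a common upper index. A \(\mathcal V\)-dcpo: poset with suprema of directed families indexed by types in \(\mathcal V\); Scott continuous maps preserve these. Way-below: \(x\ll y\) iff for every directed \(\alpha:I\to D\), \(I:\mathcal V\), with \(y\sqsubseteq\bigsqcup\alpha\) there exists \(i\) with \(x\sqsubseteq\alpha_i\); \(x\) is compact if \(x\ll x\). A small basis: \(\beta:B\to D\), \(B:\mathcal V\), such that for each \(x\) the family \(\Sigma_{b:B}(\beta(b)\ll x)\to D\) (via \(\beta\)) is directed with supremum \(x\) and each \(\beta(b)\ll x\) is \(\mathcal V\)-small. A small compact basis: \(\beta:B\to D\), \(B:\mathcal V\), with each \(\beta(b)\) compact, each family \(\Sigma_{b:B}(\beta(b)\sqsubseteq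 x)\to D\) directed with supremum \(x\), and each \(\beta(b)\sqsubseteq x\) \(\mathcal V\)-small. (A dcpo with a small basis is locally small, which is why \(\beta(b)\sqsubseteq\beta(c)\) is \(\mathcal V\)-small.) Abstract \(\mathcal V\)-basis: \(B:\mathcal V\) with proposition-valued transitive \(\prec:B\to B\to\mathcal V\) satisfying nullary interpolation (every \(a\) has some \(b\prec a\)) and binary interpolation (if \(a_1,a_2\prec b\) there is \(a\) with \(a_1,a_2\prec a\prec b\)). Ideals: subsets \(I:B\to\Omega_{\mathcal V}\) that are \(\prec\)-lower sets and \(\prec\)-directed; \(\mathrm{Idl}_{\mathcal V}(B,\prec)\) is the \(\mathcal V\)-dcpo of ideals under inclusion. An embedding-projection pair from \(D\) to \(E\) is a pair of Scott continuous maps \(\varepsilon:D\to E\), \(\pi:E\to D\) with \(\pi\circ\varepsilon=\mathrm{id}\) and \(\varepsilon(\pi(y))\sqsubseteq y\) for all \(y\). \(D\) is a Scott continuous retract of \(E\) if there are Scott continuous \(s:D\to E\), \(r:E\to D\) with \(r\circ s = \mathrm{id}\). Algebraicity data assigns to each \(x\) a directed family, indexed by a type in \(\mathcal V\), of compact elements with supremum \(x\); algebraic means such data exists (truncated). -}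

module Defs where

open import Level using (Level; _⊔_; Setω) renaming (suc to lsuc)
open import Data.Product using (Σ; Σ-syntax; _×_; _,_; proj₁; proj₂)
open import Function.Bundles using (_↔_)
open import Relation.Binary.PropositionalEquality using (_≡_; refl; sym; trans; cong; cong₂)
open import Relation.Binary.PropositionalEquality.Properties using (trans-symˡ)
open import Axiom.Extensionality.Propositional using (Extensionality)

isProp : ∀ {a} → Set a → Set a
isProp A = (x y : A) → x ≡ y

record PropTrunc : Setω where
  field
    ∥_∥ : ∀ {a} → Set a → Set a
    ∥∥-isProp : ∀ {a} {A : Set a} → isProp ∥ A ∥
    ∣_∣ : ∀ {a} {A : Set a} → A → ∥ A ∥
    ∥∥-rec : ∀ {a b} {A : Set a} {P : Set b} → isProp P → (A → P) → ∥ A ∥ → P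

FunExt : Setω
FunExt = ∀ {a b} → Extensionality a b

PropExt : (𝓥 : Level) → Set (lsuc 𝓥)
PropExt 𝓥 = {P Q : Set 𝓥} → isProp P → isProp Q → (P → Q) → (Q → P) → P ≡ Q

isSmall : ∀ {a} (𝓥 : Level) → Set a → Set (lsuc 𝓥 ⊔ a)
isSmall 𝓥 X = Σ[ Y ∈ Set 𝓥 ] (Y ↔ X)

Ω : (𝓥 : Level) → Set (lsuc 𝓥)
Ω 𝓥 = Σ[ P ∈ Set 𝓥 ] isProp P

isProp-Π : FunExt → ∀ {a b} {A : Set a} {B : A → Set b}
         → ((x : A) → isProp (B x)) → isProp ((x : A) → B x)
isProp-Π fe h f g = fe (λ x → h x (f x) (g x))

isProp-× : ∀ {a b} {A : Set a} {B : Set b} → isProp A → isProp B → isProp (A × B)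
isProp-× pA pB (a , b) (a' , b') = cong₂ _,_ (pA a a') (pB b b')

isProp→isSet : ∀ {a} {A : Set a} → isProp A → (x y : A) → isProp (x ≡ y)
isProp→isSet {A = A} pA x y q r = trans (sym (lem q)) (lem r)
  where
    lem : ∀ {z} (q : x ≡ z) → trans (sym (pA x x)) (pA x z) ≡ q
    lem refl = trans-symˡ (pA x x)

isProp-isProp : FunExt → ∀ {a} {A : Set a} → isProp (isProp A)
isProp-isProp fe f g = fe (λ x → fe (λ y → isProp→isSet f x y (f x y) (g x y)))

Ω-≡ : FunExt → ∀ {𝓥} → PropExt 𝓥 → (P Q : Ω 𝓥)
    → (proj₁ P → proj₁ Q) → (proj₁ Q → proj₁ P) → P ≡ Q
Ω-≡ fe pe (X , p) (Y , q) f g with pe p q f g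
... | refl = cong (X ,_) (isProp-isProp fe p q)

module Domain (pt : PropTrunc) where
  open PropTrunc pt public

  ∥∥-map : ∀ {a b} {A : Set a} {B : Set b} → (A → B) → ∥ A ∥ → ∥ B ∥
  ∥∥-map f = ∥∥-rec ∥∥-isProp (λ a → ∣ f a ∣)

  isDirected : ∀ {i x t} {I : Set i} {X : Set x} (_≤_ : X → X → Set t)
             → (I → X) → Set (i ⊔ t)
  isDirected {I = I} _≤_ α =
    ∥ I ∥ × ((i j : I) → ∥ Σ[ k ∈ I ] ((α i ≤ α k) × (α j ≤ α k)) ∥)

  isUpperBound : ∀ {i x t} {I : Set i} {X : Set x} (_≤_ : X → X → Set t)
               → (I → X) → X → Set (i ⊔ t)
  isUpperBound _≤_ α u = ∀ i → α i ≤ u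

  isSup : ∀ {i x t} {I : Set i} {X : Set x} (_≤_ : X → X → Set t)
        → (I → X) → X → Set (i ⊔ x ⊔ t)
  isSup _≤_ α s = isUpperBound _≤_ α s × (∀ u → isUpperBound _≤_ α u → s ≤ u)

  record Dcpo (𝓥 𝓤 𝓣 : Level) : Set (lsuc (𝓥 ⊔ 𝓤 ⊔ 𝓣)) where
    field
      Carrier : Set 𝓤
      _⊑_ : Carrier → Carrier → Set 𝓣
      ⊑-prop-valued : ∀ x y → isProp (x ⊑ y)
      ⊑-refl : ∀ x → x ⊑ x
      ⊑-trans : ∀ x y z → x ⊑ y → y ⊑ z → x ⊑ z
      ⊑-antisym : ∀ x y → x ⊑ y → y ⊑ x → x ≡ y
      ∐ : {I : Set 𝓥} (α : I → Carrier) → isDirected _⊑_ α → Carrier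
      ∐-is-sup : {I : Set 𝓥} (α : I → Carrier) (δ : isDirected _⊑_ α)
               → isSup _⊑_ α (∐ α δ)

  ⟨_⟩ : ∀ {𝓥 𝓤 𝓣} → Dcpo 𝓥 𝓤 𝓣 → Set 𝓤
  ⟨ D ⟩ = Dcpo.Carrier D

  infix 4 [_]_⊑_ [_]_≪_

  [_]_⊑_ : ∀ {𝓥 𝓤 𝓣} (D : Dcpo 𝓥 𝓤 𝓣) → ⟨ D ⟩ → ⟨ D ⟩ → Set 𝓣
  [ D ] x ⊑ y = Dcpo._⊑_ D x y

  [_]_≪_ : ∀ {𝓥 𝓤 𝓣} (D : Dcpo 𝓥 𝓤 𝓣) → ⟨ D ⟩ → ⟨ D ⟩ → Set (lsuc 𝓥 ⊔ 𝓤 ⊔ 𝓣)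
  [_]_≪_ {𝓥} D x y =
    (I : Set 𝓥) (α : I → ⟨ D ⟩) (δ : isDirected (Dcpo._⊑_ D) α)
    → [ D ] y ⊑ Dcpo.∐ D α δ → ∥ Σ[ i ∈ I ] ([ D ] x ⊑ α i) ∥

  isCompact : ∀ {𝓥 𝓤 𝓣} (D : Dcpo 𝓥 𝓤 𝓣) → ⟨ D ⟩ → Set (lsuc 𝓥 ⊔ 𝓤 ⊔ 𝓣)
  isCompact D x = [ D ] x ≪ x

  isScottContinuous : ∀ {𝓥 𝓤 𝓣 𝓤' 𝓣'} (D : Dcpo 𝓥 𝓤 𝓣) (E : Dcpo 𝓥 𝓤' 𝓣')
                    → (⟨ D ⟩ → ⟨ E ⟩) → Set (lsuc 𝓥 ⊔ 𝓤 ⊔ 𝓣 ⊔ 𝓤' ⊔ 𝓣')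
  isScottContinuous {𝓥} D E f =
    {I : Set 𝓥} (α : I → ⟨ D ⟩) (δ : isDirected (Dcpo._⊑_ D) α)
    → isSup (Dcpo._⊑_ E) (λ i → f (α i)) (f (Dcpo.∐ D α δ))

  record isSmallBasis {𝓥 𝓤 𝓣} (D : Dcpo 𝓥 𝓤 𝓣) {B : Set 𝓥} (β : B → ⟨ D ⟩)
         : Set (lsuc 𝓥 ⊔ 𝓤 ⊔ 𝓣) where
    field
      ≪ᴮ-is-small : ∀ x b → isSmall 𝓥 ([ D ] β b ≪ x)
      ↡ᴮ-is-directed : ∀ x → isDirected (Dcpo._⊑_ D)
                               (λ (p : Σ[ b ∈ B ] ([ D ] β b ≪ x)) → β (proj₁ p))
      ↡ᴮ-is-sup : ∀ x → isSup (Dcpo._⊑_ D)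
                          (λ (p : Σ[ b ∈ B ] ([ D ] β b ≪ x)) → β (proj₁ p)) x

  record isSmallCompactBasis {𝓥 𝓤 𝓣} (D : Dcpo 𝓥 𝓤 𝓣) {B : Set 𝓥} (β : B → ⟨ D ⟩)
         : Set (lsuc 𝓥 ⊔ 𝓤 ⊔ 𝓣) where
    field
      basis-is-compact : ∀ b → isCompact D (β b)
      ⊑ᴮ-is-small : ∀ x b → isSmall 𝓥 ([ D ] β b ⊑ x)
      ↓ᴮ-is-directed : ∀ x → isDirected (Dcpo._⊑_ D)
                               (λ (p : Σ[ b ∈ B ] ([ D ] β b ⊑ x)) → β (proj₁ p))
      ↓ᴮ-is-sup : ∀ x → isSup (Dcpo._⊑_ D)
                          (λ (p : Σ[ b ∈ B ] ([ D ] β b ⊑ x)) → β (proj₁ p)) x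

  hasSmallCompactBasis : ∀ {𝓥 𝓤 𝓣} (D : Dcpo 𝓥 𝓤 𝓣) → Set (lsuc 𝓥 ⊔ 𝓤 ⊔ 𝓣)
  hasSmallCompactBasis {𝓥} D =
    ∥ Σ[ B ∈ Set 𝓥 ] Σ[ β ∈ (B → ⟨ D ⟩) ] isSmallCompactBasis D β ∥

  AlgebraicityData : ∀ {𝓥 𝓤 𝓣} (D : Dcpo 𝓥 𝓤 𝓣) → Set (lsuc 𝓥 ⊔ 𝓤 ⊔ 𝓣)
  AlgebraicityData {𝓥} D =
    (x : ⟨ D ⟩) → Σ[ I ∈ Set 𝓥 ] Σ[ α ∈ (I → ⟨ D ⟩) ]
      ((∀ i → isCompact D (α i))
       × Σ[ δ ∈ isDirected (Dcpo._⊑_ D) α ] (Dcpo.∐ D α δ ≡ x))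

  isAlgebraic : ∀ {𝓥 𝓤 𝓣} (D : Dcpo 𝓥 𝓤 𝓣) → Set (lsuc 𝓥 ⊔ 𝓤 ⊔ 𝓣)
  isAlgebraic D = ∥ AlgebraicityData D ∥

  isEmbeddingProjectionPair : ∀ {𝓥 𝓤 𝓣 𝓤' 𝓣'} (D : Dcpo 𝓥 𝓤 𝓣) (E : Dcpo 𝓥 𝓤' 𝓣')
    → (⟨ D ⟩ → ⟨ E ⟩) → (⟨ E ⟩ → ⟨ D ⟩) → Set (lsuc 𝓥 ⊔ 𝓤 ⊔ 𝓣 ⊔ 𝓤' ⊔ 𝓣')
  isEmbeddingProjectionPair D E ε π =
    isScottContinuous D E ε × isScottContinuous E D π
    × (∀ x → π (ε x) ≡ x) × (∀ y → [ E ] ε (π y) ⊑ y)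

  isScottContinuousRetract : ∀ {𝓥 𝓤 𝓣 𝓤' 𝓣'} (D : Dcpo 𝓥 𝓤 𝓣) (E : Dcpo 𝓥 𝓤' 𝓣')
    → Set (lsuc 𝓥 ⊔ 𝓤 ⊔ 𝓣 ⊔ 𝓤' ⊔ 𝓣')
  isScottContinuousRetract D E =
    Σ[ s ∈ (⟨ D ⟩ → ⟨ E ⟩) ] Σ[ r ∈ (⟨ E ⟩ → ⟨ D ⟩) ]
      (isScottContinuous D E s × isScottContinuous E D r × (∀ x → r (s x) ≡ x))

  record isAbstractBasis {𝓥} {B : Set 𝓥} (_≺_ : B → B → Set 𝓥) : Set 𝓥 where
    field
      ≺-prop-valued : ∀ a b → isProp (a ≺ b)
      ≺-trans : ∀ a b c → a ≺ b → b ≺ c → a ≺ c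
      nullary-interpolation : ∀ a → ∥ Σ[ b ∈ B ] (b ≺ a) ∥
      binary-interpolation : ∀ a₁ a₂ b → a₁ ≺ b → a₂ ≺ b
                           → ∥ Σ[ a ∈ B ] ((a₁ ≺ a) × (a₂ ≺ a) × (a ≺ b)) ∥

  module _ {𝓥} {B : Set 𝓥} (_≺_ : B → B → Set 𝓥) where

    Subset : Set (lsuc 𝓥)
    Subset = B → Ω 𝓥

    _∈ˢ_ : B → Subset → Set 𝓥
    b ∈ˢ S = proj₁ (S b)

    isLowerSet : Subset → Set 𝓥
    isLowerSet S = ∀ a b → a ≺ b → b ∈ˢ S → a ∈ˢ S

    isDirectedSet : Subset → Set 𝓥
    isDirectedSet S = ∥ Σ[ b ∈ B ] (b ∈ˢ S) ∥
      × (∀ a b → a ∈ˢ S → b ∈ˢ S → ∥ Σ[ c ∈ B ] ((c ∈ˢ S) × (a ≺ c) × (b ≺ c)) ∥)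

    isIdeal : Subset → Set 𝓥
    isIdeal S = isLowerSet S × isDirectedSet S

    Ideal : Set (lsuc 𝓥)
    Ideal = Σ[ S ∈ Subset ] isIdeal S

    _∈ᴵ_ : B → Ideal → Set 𝓥
    b ∈ᴵ I = b ∈ˢ proj₁ I

    _⊆ᴵ_ : Ideal → Ideal → Set 𝓥
    I ⊆ᴵ J = ∀ b → b ∈ᴵ I → b ∈ᴵ J

    ∈ᴵ-prop : ∀ b I → isProp (b ∈ᴵ I)
    ∈ᴵ-prop b I = proj₂ (proj₁ I b)

    module _ (fe : FunExt) (pe : PropExt 𝓥) where

      private
        isIdeal-prop : ∀ S → isProp (isIdeal S)
        isIdeal-prop S =
          isProp-× (isProp-Π fe λ a → isProp-Π fe λ b → isProp-Π fe λ _ →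
                      isProp-Π fe λ _ → proj₂ (S a))
                   (isProp-× ∥∥-isProp
                      (isProp-Π fe λ _ → isProp-Π fe λ _ → isProp-Π fe λ _ →
                         isProp-Π fe λ _ → ∥∥-isProp))

        antisym : ∀ I J → I ⊆ᴵ J → J ⊆ᴵ I → I ≡ J
        antisym (S , s) (T , t) f g
          with fe {B = λ _ → Ω 𝓥} (λ b → Ω-≡ fe pe (S b) (T b) (f b) (g b))
        ... | refl = cong (S ,_) (isIdeal-prop S s t)

        ⊆-prop : ∀ I J → isProp (I ⊆ᴵ J)
        ⊆-prop I J = isProp-Π fe λ b → isProp-Π fe λ _ → ∈ᴵ-prop b J

        module Sup {I : Set 𝓥} (α : I → Ideal) (δ : isDirected _⊆ᴵ_ α) where
          S : Subset
          S b = ∥ Σ[ i ∈ I ] (b ∈ᴵ α i) ∥ , ∥∥-isProp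

          lower : isLowerSet S
          lower a b r = ∥∥-map (λ (i , bi) → i , proj₁ (proj₂ (α i)) a b r bi)

          inh : ∥ Σ[ b ∈ B ] (b ∈ˢ S) ∥
          inh = ∥∥-rec ∥∥-isProp
                  (λ i → ∥∥-map (λ (b , bi) → b , ∣ i , bi ∣)
                                (proj₁ (proj₂ (proj₂ (α i)))))
                  (proj₁ δ)

          semi : ∀ a b → a ∈ˢ S → b ∈ˢ S
               → ∥ Σ[ c ∈ B ] ((c ∈ˢ S) × (a ≺ c) × (b ≺ c)) ∥
          semi a b ma mb =
            ∥∥-rec ∥∥-isProp (λ (i , ai) →
            ∥∥-rec ∥∥-isProp (λ (j , bj) →
            ∥∥-rec ∥∥-isProp (λ (k , ik , jk) →
              ∥∥-map (λ (c , ck , ac , bc) → c , ∣ k , ck ∣ , ac , bc)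
                     (proj₂ (proj₂ (proj₂ (α k))) a b (ik a ai) (jk b bj)))
              (proj₂ δ i j)) mb) ma

          sup : Ideal
          sup = S , lower , inh , semi

          is-sup : isSup _⊆ᴵ_ α sup
          is-sup = (λ i b bi → ∣ i , bi ∣)
                 , (λ u ub b m → ∥∥-rec (∈ᴵ-prop b u) (λ (i , bi) → ub i b bi) m)

      Idl : Dcpo 𝓥 (lsuc 𝓥) 𝓥
      Idl = record
        { Carrier = Ideal
        ; _⊑_ = _⊆ᴵ_
        ; ⊑-prop-valued = ⊆-prop
        ; ⊑-refl = λ I b m → m
        ; ⊑-trans = λ I J K f g b m → g b (f b m)
        ; ⊑-antisym = antisym
        ; ∐ = Sup.sup
        ; ∐-is-sup = Sup.is-sup
        }

-- ε x collects the basis elements way below x, and π I is the supremum of β over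
-- the ideal I. Then π (ε x) = x because β is a basis, ε (π I) ⊆ I because an
-- element way below ∐ β[I] lies below some member of I, and ε is Scott continuous
-- because β b ≪ ∐ α already forces β b ≪ α j for some j: approximate each α j by
-- basis elements way below it, whose (small) directed family has the same supremum.
-- For a compact basis β b ⊑ π I gives β b ≪ π I, so ε (π I) = I. The ideals
-- themselves form an algebraic dcpo with the principal ideals as compact basis.
module Submission where

open import Level using (Level)
open import Data.Product using (Σ-syntax; _×_; _,_; proj₁; proj₂)
open import Function using (_∘_)
open import Function.Bundles using (_⇔_; mk⇔; mk↔ₛ′; Equivalence; Inverse)
open import Relation.Binary.PropositionalEquality using (_≡_)
open import Defs

module DcpoProperties (pt : PropTrunc) {𝓥 𝓤 𝓣 : Level} (D : Domain.Dcpo pt 𝓥 𝓤 𝓣) where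
  open Domain pt
  open Dcpo D

  ≪-isProp : FunExt → ∀ x y → isProp ([ D ] x ≪ y)
  ≪-isProp fe x y = isProp-Π fe λ _ → isProp-Π fe λ _ → isProp-Π fe λ _ →
                    isProp-Π fe λ _ → ∥∥-isProp

  ⊑-≪-trans : ∀ {x y z} → x ⊑ y → [ D ] y ≪ z → [ D ] x ≪ z
  ⊑-≪-trans x⊑y y≪z I α δ z⊑∐ =
    ∥∥-map (λ (i , y⊑αi) → i , ⊑-trans _ _ _ x⊑y y⊑αi) (y≪z I α δ z⊑∐)

  ≪-⊑-trans : ∀ {x y z} → [ D ] x ≪ y → y ⊑ z → [ D ] x ≪ z
  ≪-⊑-trans x≪y y⊑z I α δ z⊑∐ = x≪y I α δ (⊑-trans _ _ _ y⊑z z⊑∐)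

  ∐-≡-sup : ∀ {I : Set 𝓥} {α : I → Carrier} (δ : isDirected _⊑_ α) {x}
          → isSup _⊑_ α x → ∐ α δ ≡ x
  ∐-≡-sup {α = α} δ (x-ub , x-lub) =
    ⊑-antisym _ _ (proj₂ (∐-is-sup α δ) _ x-ub) (x-lub _ (proj₁ (∐-is-sup α δ)))

  smallCompactBasis⇒algebraicityData : {B : Set 𝓥} {β : B → Carrier}
                                     → isSmallCompactBasis D β → AlgebraicityData D
  smallCompactBasis⇒algebraicityData {B} {β} scb x =
    ↓ₛ , β ∘ proj₁ , (λ (b , _) → basis-is-compact b) , ↓ₛ-directed
    , ∐-≡-sup ↓ₛ-directed
        ( (λ (b , b⊑ₛx) → ⊑ₛ⇒⊑ b⊑ₛx)
        , λ u u-ub → proj₂ (↓ᴮ-is-sup x) u (λ (b , b⊑x) → u-ub (b , ⊑⇒⊑ₛ b⊑x)))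
    where
      open isSmallCompactBasis scb

      ↓ₛ : Set 𝓥
      ↓ₛ = Σ[ b ∈ B ] proj₁ (⊑ᴮ-is-small x b)

      ⊑ₛ⇒⊑ : ∀ {b} → proj₁ (⊑ᴮ-is-small x b) → β b ⊑ x
      ⊑ₛ⇒⊑ {b} = Inverse.to (proj₂ (⊑ᴮ-is-small x b))

      ⊑⇒⊑ₛ : ∀ {b} → β b ⊑ x → proj₁ (⊑ᴮ-is-small x b)
      ⊑⇒⊑ₛ {b} = Inverse.from (proj₂ (⊑ᴮ-is-small x b))

      ↓ₛ-directed : isDirected _⊑_ (β ∘ proj₁)
      ↓ₛ-directed =
          ∥∥-map (λ (b , b⊑x) → b , ⊑⇒⊑ₛ b⊑x) (proj₁ (↓ᴮ-is-directed x))
        , λ (b , b⊑ₛx) (c , c⊑ₛx) →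
            ∥∥-map (λ ((d , d⊑x) , b⊑d , c⊑d) → (d , ⊑⇒⊑ₛ d⊑x) , b⊑d , c⊑d)
                   (proj₂ (↓ᴮ-is-directed x) (b , ⊑ₛ⇒⊑ b⊑ₛx) (c , ⊑ₛ⇒⊑ c⊑ₛx))

module IdealProperties (pt : PropTrunc) {𝓥 : Level} {B : Set 𝓥} (_≺_ : B → B → Set 𝓥) where
  open Domain pt

  _∈_ : B → Ideal _≺_ → Set 𝓥
  _∈_ = _∈ᴵ_ _≺_

  _⊆_ : Ideal _≺_ → Ideal _≺_ → Set 𝓥
  _⊆_ = _⊆ᴵ_ _≺_

  ideal-lower : ∀ I a b → a ≺ b → b ∈ I → a ∈ I
  ideal-lower I = proj₁ (proj₂ I)

  ideal-inhabited : ∀ I → ∥ Σ[ b ∈ B ] (b ∈ I) ∥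
  ideal-inhabited I = proj₁ (proj₂ (proj₂ I))

  ideal-semidirected : ∀ I a b → a ∈ I → b ∈ I
                     → ∥ Σ[ c ∈ B ] ((c ∈ I) × (a ≺ c) × (b ≺ c)) ∥
  ideal-semidirected I = proj₂ (proj₂ (proj₂ I))

module PreorderIdealCompletion (pt : PropTrunc) (fe : FunExt) {𝓥 : Level} (pe : PropExt 𝓥)
  {B : Set 𝓥} (_≼_ : B → B → Set 𝓥) (≼-isProp : ∀ a b → isProp (a ≼ b))
  (≼-refl : ∀ a → a ≼ a) (≼-trans : ∀ a b c → a ≼ b → b ≼ c → a ≼ c) where
  open Domain pt
  open IdealProperties pt _≼_
  open DcpoProperties pt (Idl _≼_ fe pe)

  reflexive⇒isAbstractBasis : isAbstractBasis _≼_
  reflexive⇒isAbstractBasis = record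
    { ≺-prop-valued = ≼-isProp
    ; ≺-trans = ≼-trans
    ; nullary-interpolation = λ a → ∣ a , ≼-refl a ∣
    ; binary-interpolation = λ a₁ a₂ b a₁≼b a₂≼b → ∣ b , a₁≼b , a₂≼b , ≼-refl b ∣
    }

  ↓ : B → Ideal _≼_
  ↓ b = (λ a → a ≼ b , ≼-isProp a b)
      , (λ a c a≼c c≼b → ≼-trans a c b a≼c c≼b)
      , ∣ b , ≼-refl b ∣
      , (λ a c a≼b c≼b → ∣ b , ≼-refl b , a≼b , c≼b ∣)

  ↓-mono : ∀ {b c} → b ≼ c → ↓ b ⊆ ↓ c
  ↓-mono b≼c a a≼b = ≼-trans _ _ _ a≼b b≼c

  ↓⊆⇔∈ : ∀ b I → (↓ b ⊆ I) ⇔ (b ∈ I)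
  ↓⊆⇔∈ b I = mk⇔ (λ ↓b⊆I → ↓b⊆I b (≼-refl b)) (λ b∈I a a≼b → ideal-lower I a b a≼b b∈I)

  ↓-isCompact : ∀ b → isCompact (Idl _≼_ fe pe) (↓ b)
  ↓-isCompact b J α δ ↓b⊆∐α =
    ∥∥-map (λ (j , b∈αj) → j , Equivalence.from (↓⊆⇔∈ b (α j)) b∈αj) (↓b⊆∐α b (≼-refl b))

  ↓-directed : ∀ I → isDirected _⊆_ (λ (p : Σ[ b ∈ B ] (↓ b ⊆ I)) → ↓ (proj₁ p))
  ↓-directed I =
      ∥∥-map (λ (b , b∈I) → b , Equivalence.from (↓⊆⇔∈ b I) b∈I) (ideal-inhabited I)
    , λ (b , ↓b⊆I) (c , ↓c⊆I) →
        ∥∥-map (λ (d , d∈I , b≼d , c≼d) → (d , Equivalence.from (↓⊆⇔∈ d I) d∈I)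
                                          , ↓-mono b≼d , ↓-mono c≼d)
               (ideal-semidirected I b c (↓b⊆I b (≼-refl b)) (↓c⊆I c (≼-refl c)))

  ↓-isSup : ∀ I → isSup _⊆_ (λ (p : Σ[ b ∈ B ] (↓ b ⊆ I)) → ↓ (proj₁ p)) I
  ↓-isSup I = (λ (b , ↓b⊆I) → ↓b⊆I)
            , λ J J-ub b b∈I → J-ub (b , Equivalence.from (↓⊆⇔∈ b I) b∈I) b (≼-refl b)

  ↓-isSmallCompactBasis : isSmallCompactBasis (Idl _≼_ fe pe) ↓
  ↓-isSmallCompactBasis = record
    { basis-is-compact = ↓-isCompact
    ; ⊑ᴮ-is-small = λ I b → b ∈ I , mk↔ₛ′ (Equivalence.from (↓⊆⇔∈ b I)) (Equivalence.to (↓⊆⇔∈ b I))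
                                         (λ _ → Dcpo.⊑-prop-valued (Idl _≼_ fe pe) (↓ b) I _ _)
                                         (λ _ → ∈ᴵ-prop _≼_ b I _ _)
    ; ↓ᴮ-is-directed = ↓-directed
    ; ↓ᴮ-is-sup = ↓-isSup
    }

  Idl-isAlgebraic : isAlgebraic (Idl _≼_ fe pe)
  Idl-isAlgebraic = ∣ smallCompactBasis⇒algebraicityData ↓-isSmallCompactBasis ∣

module SmallBasisProperties (pt : PropTrunc) (fe : FunExt) {𝓥 𝓤 𝓣 : Level}
  (D : Domain.Dcpo pt 𝓥 𝓤 𝓣) {B : Set 𝓥} (β : B → Domain.⟨_⟩ pt D)
  (sb : Domain.isSmallBasis pt D β) where
  open Domain pt
  open Dcpo D
  open isSmallBasis sb
  open DcpoProperties pt D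

  -- Truncating the small copy of β b ≪ x yields a 𝓥-valued proposition.
  _≪ₛ_ : B → Carrier → Set 𝓥
  b ≪ₛ x = ∥ proj₁ (≪ᴮ-is-small x b) ∥

  ≪ₛ⇒≪ : ∀ {b x} → b ≪ₛ x → [ D ] β b ≪ x
  ≪ₛ⇒≪ {b} {x} = ∥∥-rec (≪-isProp fe _ _) (Inverse.to (proj₂ (≪ᴮ-is-small x b)))

  ≪⇒≪ₛ : ∀ {b x} → [ D ] β b ≪ x → b ≪ₛ x
  ≪⇒≪ₛ {b} {x} b≪x = ∣ Inverse.from (proj₂ (≪ᴮ-is-small x b)) b≪x ∣

  ≪ᴮ⇒⊑ : ∀ {b x} → [ D ] β b ≪ x → β b ⊑ x
  ≪ᴮ⇒⊑ {b} {x} b≪x = proj₁ (↡ᴮ-is-sup x) (b , b≪x)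

  module _ {J : Set 𝓥} (α : J → Carrier) (δ : isDirected _⊑_ α) where
    private
      Approximant : Set 𝓥
      Approximant = Σ[ j ∈ J ] Σ[ c ∈ B ] (c ≪ₛ α j)

      γ : Approximant → Carrier
      γ (_ , c , _) = β c

      γ-directed : isDirected _⊑_ γ
      γ-directed =
          ∥∥-rec ∥∥-isProp (λ j → ∥∥-map (λ (c , c≪αj) → j , c , ≪⇒≪ₛ c≪αj)
                                         (proj₁ (↡ᴮ-is-directed (α j))))
                 (proj₁ δ)
        , λ (i , c , c≪αi) (j , d , d≪αj) →
            ∥∥-rec ∥∥-isProp
              (λ (k , αi⊑αk , αj⊑αk) →
                 ∥∥-map (λ ((e , e≪αk) , c⊑e , d⊑e) → (k , e , ≪⇒≪ₛ e≪αk) , c⊑e , d⊑e)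
                        (proj₂ (↡ᴮ-is-directed (α k)) (c , ≪-⊑-trans (≪ₛ⇒≪ c≪αi) αi⊑αk)
                                                      (d , ≪-⊑-trans (≪ₛ⇒≪ d≪αj) αj⊑αk)))
              (proj₂ δ i j)

      ∐α⊑∐γ : ∐ α δ ⊑ ∐ γ γ-directed
      ∐α⊑∐γ = proj₂ (∐-is-sup α δ) _ λ j →
                proj₂ (↡ᴮ-is-sup (α j)) _ λ (c , c≪αj) →
                  proj₁ (∐-is-sup γ γ-directed) (j , c , ≪⇒≪ₛ c≪αj)

    ≪ᴮ-∐⇒∃≪ᴮ : ∀ b → [ D ] β b ≪ ∐ α δ → ∥ Σ[ j ∈ J ] ([ D ] β b ≪ α j) ∥
    ≪ᴮ-∐⇒∃≪ᴮ b b≪∐α =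
      ∥∥-map (λ ((j , c , c≪αj) , b⊑c) → j , ⊑-≪-trans b⊑c (≪ₛ⇒≪ c≪αj))
             (b≪∐α Approximant γ γ-directed ∐α⊑∐γ)

module EmbeddingProjection (pt : PropTrunc) (fe : FunExt) {𝓥 𝓤 𝓣 : Level} (pe : PropExt 𝓥)
  (D : Domain.Dcpo pt 𝓥 𝓤 𝓣) {B : Set 𝓥} (β : B → Domain.⟨_⟩ pt D)
  (sb : Domain.isSmallBasis pt D β)
  (_⊑β_ : B → B → Set 𝓥)
  (⊑β⇔⊑ : ∀ b c → (b ⊑β c) ⇔ (Domain.[_]_⊑_ pt D (β b) (β c))) where
  open Domain pt
  open Dcpo D
  open isSmallBasis sb
  open DcpoProperties pt D
  open SmallBasisProperties pt fe D β sb
  open IdealProperties pt _⊑β_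

  ⊑β⇒⊑ : ∀ {b c} → b ⊑β c → β b ⊑ β c
  ⊑β⇒⊑ {b} {c} = Equivalence.to (⊑β⇔⊑ b c)

  ⊑⇒⊑β : ∀ {b c} → β b ⊑ β c → b ⊑β c
  ⊑⇒⊑β {b} {c} = Equivalence.from (⊑β⇔⊑ b c)

  ε : Carrier → Ideal _⊑β_
  ε x = (λ b → b ≪ₛ x , ∥∥-isProp)
      , (λ a b a⊑b b≪x → ≪⇒≪ₛ (⊑-≪-trans (⊑β⇒⊑ a⊑b) (≪ₛ⇒≪ b≪x)))
      , ∥∥-map (λ (b , b≪x) → b , ≪⇒≪ₛ b≪x) (proj₁ (↡ᴮ-is-directed x))
      , λ a b a≪x b≪x →
          ∥∥-map (λ ((c , c≪x) , a⊑c , b⊑c) → c , ≪⇒≪ₛ c≪x , ⊑⇒⊑β a⊑c , ⊑⇒⊑β b⊑c)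
                 (proj₂ (↡ᴮ-is-directed x) (a , ≪ₛ⇒≪ a≪x) (b , ≪ₛ⇒≪ b≪x))

  ∈ε⇔≪ : ∀ x b → (b ∈ ε x) ⇔ ([ D ] β b ≪ x)
  ∈ε⇔≪ x b = mk⇔ ≪ₛ⇒≪ ≪⇒≪ₛ

  β[_] : (I : Ideal _⊑β_) → Σ[ b ∈ B ] (b ∈ I) → Carrier
  β[ I ] (b , _) = β b

  β[]-directed : ∀ I → isDirected _⊑_ β[ I ]
  β[]-directed I =
      ideal-inhabited I
    , λ (a , a∈I) (b , b∈I) →
        ∥∥-map (λ (c , c∈I , a⊑c , b⊑c) → (c , c∈I) , ⊑β⇒⊑ a⊑c , ⊑β⇒⊑ b⊑c)
               (ideal-semidirected I a b a∈I b∈I)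

  π : Ideal _⊑β_ → Carrier
  π I = ∐ β[ I ] (β[]-directed I)

  β-⊑-π : ∀ I {b} → b ∈ I → β b ⊑ π I
  β-⊑-π I {b} b∈I = proj₁ (∐-is-sup β[ I ] (β[]-directed I)) (b , b∈I)

  π∘ε : ∀ x → π (ε x) ≡ x
  π∘ε x = ∐-≡-sup (β[]-directed (ε x))
            ( (λ (b , b≪x) → ≪ᴮ⇒⊑ (≪ₛ⇒≪ b≪x))
            , λ u u-ub → proj₂ (↡ᴮ-is-sup x) u (λ (b , b≪x) → u-ub (b , ≪⇒≪ₛ b≪x)))

  ε∘π-deflationary : ∀ I → ε (π I) ⊆ I
  ε∘π-deflationary I b b≪πI =
    ∥∥-rec (∈ᴵ-prop _⊑β_ b I) (λ ((c , c∈I) , b⊑c) → ideal-lower I b c (⊑⇒⊑β b⊑c) c∈I)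
           (≪ₛ⇒≪ b≪πI _ β[ I ] (β[]-directed I) (⊑-refl (π I)))

  ε∘π-compact : isSmallCompactBasis D β → ∀ I → ε (π I) ≡ I
  ε∘π-compact scb I =
    Dcpo.⊑-antisym (Idl _⊑β_ fe pe) _ _ (ε∘π-deflationary I)
      λ b b∈I → ≪⇒≪ₛ (≪-⊑-trans (isSmallCompactBasis.basis-is-compact scb b) (β-⊑-π I b∈I))

  ε-mono : ∀ {x y} → x ⊑ y → ε x ⊆ ε y
  ε-mono x⊑y b b≪x = ≪⇒≪ₛ (≪-⊑-trans (≪ₛ⇒≪ b≪x) x⊑y)

  ε-isScottContinuous : isScottContinuous D (Idl _⊑β_ fe pe) ε
  ε-isScottContinuous α δ =
      (λ j → ε-mono (proj₁ (∐-is-sup α δ) j))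
    , λ U U-ub b b≪∐α →
        ∥∥-rec (∈ᴵ-prop _⊑β_ b U) (λ (j , b≪αj) → U-ub j b (≪⇒≪ₛ b≪αj))
               (≪ᴮ-∐⇒∃≪ᴮ α δ b (≪ₛ⇒≪ b≪∐α))

  π-mono : ∀ {I J} → I ⊆ J → π I ⊑ π J
  π-mono {I} {J} I⊆J = proj₂ (∐-is-sup β[ I ] (β[]-directed I)) _ λ (b , b∈I) → β-⊑-π J (I⊆J b b∈I)

  π-isScottContinuous : isScottContinuous (Idl _⊑β_ fe pe) D π
  π-isScottContinuous α δ =
      (λ j → π-mono {α j} {Dcpo.∐ (Idl _⊑β_ fe pe) α δ} (proj₁ (Dcpo.∐-is-sup (Idl _⊑β_ fe pe) α δ) j))
    , λ u u-ub → proj₂ (∐-is-sup _ _) u λ (b , b∈∐α) →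
        ∥∥-rec (⊑-prop-valued _ _) (λ (j , b∈αj) → ⊑-trans _ _ _ (β-⊑-π (α j) b∈αj) (u-ub j))
               b∈∐α

  isEmbeddingProjectionPair-ε-π : isEmbeddingProjectionPair D (Idl _⊑β_ fe pe) ε π
  isEmbeddingProjectionPair-ε-π =
    ε-isScottContinuous , π-isScottContinuous , π∘ε , ε∘π-deflationary

theorem6p31 : (pt : PropTrunc) (fe : FunExt) {𝓥 𝓤 𝓣 : Level} (pe : PropExt 𝓥)
    → let open Domain pt in
      (D : Dcpo 𝓥 𝓤 𝓣) {B : Set 𝓥} (β : B → ⟨ D ⟩) → isSmallBasis D β
    → (_⊑β_ : B → B → Set 𝓥)
    → (∀ b c → isProp (b ⊑β c))
    → (∀ b c → (b ⊑β c) ⇔ ([ D ] β b ⊑ β c))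
    → isAbstractBasis _⊑β_
      × Σ[ ε ∈ (⟨ D ⟩ → ⟨ Idl _⊑β_ fe pe ⟩) ]
          ((∀ x b → (_∈ᴵ_ _⊑β_ b (ε x)) ⇔ ([ D ] β b ≪ x))
          × Σ[ π ∈ (⟨ Idl _⊑β_ fe pe ⟩ → ⟨ D ⟩) ]
              (isEmbeddingProjectionPair D (Idl _⊑β_ fe pe) ε π
              × (isSmallCompactBasis D β → ∀ I → ε (π I) ≡ I)))
      × isScottContinuousRetract D (Idl _⊑β_ fe pe)
      × isAlgebraic (Idl _⊑β_ fe pe)
      × hasSmallCompactBasis (Idl _⊑β_ fe pe)
theorem6p31 pt fe pe D {B} β sb _⊑β_ ⊑β-isProp ⊑β⇔⊑ =
    reflexive⇒isAbstractBasis
  , ε , (∈ε⇔≪ , π , isEmbeddingProjectionPair-ε-π , ε∘π-compact)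
  , (ε , π , ε-isScottContinuous , π-isScottContinuous , π∘ε)
  , Idl-isAlgebraic
  , ∣ B , ↓ , ↓-isSmallCompactBasis ∣
  where
    open Domain pt
    open Dcpo D
    open EmbeddingProjection pt fe pe D β sb _⊑β_ ⊑β⇔⊑
    open PreorderIdealCompletion pt fe pe _⊑β_ ⊑β-isProp
           (λ b → ⊑⇒⊑β (⊑-refl (β b)))
           (λ a b c a⊑b b⊑c → ⊑⇒⊑β (⊑-trans _ _ _ (⊑β⇒⊑ a⊑b) (⊑β⇒⊑ b⊑c)))
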